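{- Let $F:(\Sigma_1,\mathscr R_1)\to(\Sigma_2,\mathscr R_2)$ be a theory morphism between Dedukti theories. Then for all terms $M,N$ of $(\Sigma_1,\mathscr R_1)$: (1) $|M|_F\{|N|_F/x\}=|M\{N/x\}|_F$; (2) if $M\hookrightarrow_1N$ then $|M|_F\hookrightarrow_2^*|N|_F$; (3) if $M\equiv_1N$ then $|M|_F\equiv_2|N|_F$.
   Context: Dedukti: terms $x\mid c[\vec M]\mid\mathtt{TYPE}\mid\mathtt{KIND}\mid MN\mid\lambda x:A.M\mid\Pi x:A.B$ (constants with fixed arity), signatures of declarations $c[\Delta_c]:A_c$, rewrite rules $c[\vec l]\hookrightarrow r$; in theory $(\Sigma_i,\mathscr R_i)$, $\hookrightarrow_i$ is $\beta$ together with the context/substitution closure of $\mathscr R_i$, $\equiv_i$ its equivalence, and $\vdash_i$ Dedukti typing ($\lambda\Pi$-calculus with constants, conversion modulo $\equiv_i$). A theory pre-morphism $F$ assigns to each constant $c$ of $\Sigma_1$ a term $F_c$ over constants of $\Sigma_2$ whose free variables are among those of $\Delta_c$. It induces $|c[\vec M]|_F=F_c\{|\vec M|_F\}$ (simultaneous substitution of the arguments for the variables of $\Delta_c$), $|x|_F=x$, $|\mathtt{TYPE}|_F=\mathtt{TYPE}$, $|\mathtt{KIND}|_F=\mathtt{KIND}$, $|\Pi x:A.B|_F=\Pi x:|A|_F.|B|_F$, $|\lambda x:A.M|_F=\lambda x:|A|_F.|M|_F$, $|MN|_F=|M|_F|N|_F$, extended componentwise to contexts. It is a theory morphism if (i)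 for every $c[\Delta_c]:A_c\in\Sigma_1$, $\Sigma_2;|\Delta_c|_F\vdash_2F_c:|A_c|_F$, and (ii) for every rule $l\hookrightarrow r\in\mathscr R_1$, $|l|_F\hookrightarrow_2^*|r|_F$. -}

module Defs where

open import Data.Nat using (ℕ; zero; suc)
open import Data.Fin using (Fin; zero; suc; _≟_)
open import Data.Vec using (Vec; []; _∷_; _∷ʳ_; lookup; reverse)
open import Data.Product using (_×_; _,_)
open import Relation.Nullary using (yes; no)
open import Relation.Binary.Construct.Closure.ReflexiveTransitive using (Star)
open import Relation.Binary.Construct.Closure.Equivalence using (EqClosure)

record Consts : Set₁ where
  field
    Con   : Set
    arity : Con → ℕ
open Consts public

data Sort : Set where
  type kind : Sort

-- Well-scoped (de Bruijn) Dedukti terms over a set of constants.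
-- Tm K n = terms with free variables among Fin n.
-- con c ts is c[M_1,...,M_k] with ts = M_1 ∷ ... ∷ M_k ∷ [].

module _ (K : Consts) where

  data Tm (n : ℕ) : Set where
    var  : Fin n → Tm n
    con  : (c : Con K) → Vec (Tm n) (arity K c) → Tm n
    TYPE : Tm n
    KIND : Tm n
    app  : Tm n → Tm n → Tm n
    lam  : Tm n → Tm (suc n) → Tm n
    pi   : Tm n → Tm (suc n) → Tm n

  ⌜_⌝ : ∀ {n} → Sort → Tm n
  ⌜ type ⌝ = TYPE
  ⌜ kind ⌝ = KIND

  Ren : ℕ → ℕ → Set
  Ren m n = Fin m → Fin n

  extR : ∀ {m n} → Ren m n → Ren (suc m) (suc n)
  extR ρ zero    = zero
  extR ρ (suc i) = suc (ρ i)

  mutual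
    ren : ∀ {m n} → Ren m n → Tm m → Tm n
    ren ρ (var i)    = var (ρ i)
    ren ρ (con c ts) = con c (renV ρ ts)
    ren ρ TYPE       = TYPE
    ren ρ KIND       = KIND
    ren ρ (app M N)  = app (ren ρ M) (ren ρ N)
    ren ρ (lam A M)  = lam (ren ρ A) (ren (extR ρ) M)
    ren ρ (pi A B)   = pi (ren ρ A) (ren (extR ρ) B)

    renV : ∀ {m n k} → Ren m n → Vec (Tm m) k → Vec (Tm n) k
    renV ρ []       = []
    renV ρ (t ∷ ts) = ren ρ t ∷ renV ρ ts

  Sub : ℕ → ℕ → Set
  Sub m n = Fin m → Tm n

  extS : ∀ {m n} → Sub m n → Sub (suc m) (suc n)
  extS σ zero    = var zero
  extS σ (suc i) = ren suc (σ i)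

  mutual
    sub : ∀ {m n} → Sub m n → Tm m → Tm n
    sub σ (var i)    = σ i
    sub σ (con c ts) = con c (subV σ ts)
    sub σ TYPE       = TYPE
    sub σ KIND       = KIND
    sub σ (app M N)  = app (sub σ M) (sub σ N)
    sub σ (lam A M)  = lam (sub σ A) (sub (extS σ) M)
    sub σ (pi A B)   = pi (sub σ A) (sub (extS σ) B)

    subV : ∀ {m n k} → Sub m n → Vec (Tm m) k → Vec (Tm n) k
    subV σ []       = []
    subV σ (t ∷ ts) = sub σ t ∷ subV σ ts

  subAt : ∀ {n} → Fin n → Tm n → Sub n n
  subAt x N y with x ≟ y
  ... | yes _ = N
  ... | no  _ = var y

  sub0 : ∀ {n} → Tm n → Sub (suc n) n
  sub0 N zero    = N
  sub0 N (suc i) = var i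

  _[_]₀ : ∀ {n} → Tm (suc n) → Tm n → Tm n
  M [ N ]₀ = sub (sub0 N) M

  -- {M_1..M_k / x_1..x_k}: x_k is de Bruijn index 0, x_1 is index k-1
  vecSub : ∀ {n k} → Vec (Tm n) k → Sub k n
  vecSub ts i = lookup (reverse ts) i

  data Ctx : ℕ → Set where
    ∅   : Ctx zero
    _▸_ : ∀ {n} → Ctx n → Tm n → Ctx (suc n)

  lookupCtx : ∀ {n} → Ctx n → Fin n → Tm n
  lookupCtx (Γ ▸ A) zero    = ren suc A
  lookupCtx (Γ ▸ A) (suc i) = ren suc (lookupCtx Γ i)

  record Rule : Set where
    field
      vars    : ℕ
      head    : Con K
      lhsArgs : Vec (Tm vars) (arity K head)
      rhs     : Tm vars

    lhs : Tm vars
    lhs = con head lhsArgs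

record Theory : Set₁ where
  field
    consts   : Consts
    ctxOf    : (c : Con consts) → Ctx consts (arity consts c)
    typeOf   : (c : Con consts) → Tm consts (arity consts c)
    RuleName : Set
    rule     : RuleName → Rule consts
open Theory public

module _ (T : Theory) where
  private K = consts T

  mutual
    data Step {n : ℕ} : Tm K n → Tm K n → Set where
      β     : ∀ {A M N} → Step (app (lam A M) N) (_[_]₀ K M N)
      rw    : (r : RuleName T) (σ : Sub K (Rule.vars (rule T r)) n) →
              Step (sub K σ (Rule.lhs (rule T r))) (sub K σ (Rule.rhs (rule T r)))
      appL  : ∀ {M M′ N} → Step M M′ → Step (app M N) (app M′ N)
      appR  : ∀ {M N N′} → Step N N′ → Step (app M N) (app M N′)
      lamA  : ∀ {A A′ M} → Step A A′ → Step (lam A M) (lam A′ M)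
      lamM  : ∀ {A M M′} → Step M M′ → Step (lam A M) (lam A M′)
      piA   : ∀ {A A′ B} → Step A A′ → Step (pi A B) (pi A′ B)
      piB   : ∀ {A B B′} → Step B B′ → Step (pi A B) (pi A B′)
      conArg : ∀ {c ts us} → StepV ts us → Step (con c ts) (con c us)

    data StepV {n : ℕ} : ∀ {k} → Vec (Tm K n) k → Vec (Tm K n) k → Set where
      here  : ∀ {k t u} {ts : Vec (Tm K n) k} → Step t u → StepV (t ∷ ts) (u ∷ ts)
      there : ∀ {k t} {ts us : Vec (Tm K n) k} → StepV ts us → StepV (t ∷ ts) (t ∷ us)

  Steps : ∀ {n} → Tm K n → Tm K n → Set
  Steps = Star Step

  Conv : ∀ {n} → Tm K n → Tm K n → Set
  Conv = EqClosure Step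

  mutual
    data WfCtx : ∀ {n} → Ctx K n → Set where
      wf-∅ : WfCtx (∅)
      wf-▸ : ∀ {n} {Γ : Ctx K n} {A s} → WfCtx Γ → Typed Γ A (⌜_⌝ K s) → WfCtx (Γ ▸ A)

    data Typed {n : ℕ} (Γ : Ctx K n) : Tm K n → Tm K n → Set where
      ty-sort : WfCtx Γ → Typed Γ TYPE KIND
      ty-var  : ∀ {i} → WfCtx Γ → Typed Γ (var i) (lookupCtx K Γ i)
      ty-con  : ∀ {c ts} → WfCtx Γ → TypedArgs Γ ts (ctxOf T c) →
                Typed Γ (con c ts) (sub K (vecSub K ts) (typeOf T c))
      ty-prod : ∀ {A B s} → Typed Γ A TYPE → Typed (Γ ▸ A) B (⌜_⌝ K s) →
                Typed Γ (pi A B) (⌜_⌝ K s)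
      ty-abs  : ∀ {A B M s} → Typed Γ A TYPE → Typed (Γ ▸ A) B (⌜_⌝ K s) →
                Typed (Γ ▸ A) M B → Typed Γ (lam A M) (pi A B)
      ty-app  : ∀ {M N A B} → Typed Γ M (pi A B) → Typed Γ N A →
                Typed Γ (app M N) (_[_]₀ K B N)
      ty-conv : ∀ {M A B s} → Typed Γ M A → Typed Γ B (⌜_⌝ K s) → Conv A B →
                Typed Γ M B

    data TypedArgs {n : ℕ} (Γ : Ctx K n) : ∀ {k} → Vec (Tm K n) k → Ctx K k → Set where
      args-∅ : TypedArgs Γ [] ∅
      args-▸ : ∀ {k} {ts : Vec (Tm K n) k} {Δ A t} → TypedArgs Γ ts Δ →
               Typed Γ t (sub K (vecSub K ts) A) → TypedArgs Γ (ts ∷ʳ t) (Δ ▸ A)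

PreMorphism : Theory → Theory → Set
PreMorphism T₁ T₂ = (c : Con (consts T₁)) → Tm (consts T₂) (arity (consts T₁) c)

module _ (T₁ T₂ : Theory) (F : PreMorphism T₁ T₂) where
  private
    K₁ = consts T₁
    K₂ = consts T₂

  mutual
    tr : ∀ {n} → Tm K₁ n → Tm K₂ n
    tr (var i)    = var i
    tr (con c ts) = sub K₂ (vecSub K₂ (trV ts)) (F c)
    tr TYPE       = TYPE
    tr KIND       = KIND
    tr (app M N)  = app (tr M) (tr N)
    tr (lam A M)  = lam (tr A) (tr M)
    tr (pi A B)   = pi (tr A) (tr B)

    trV : ∀ {n k} → Vec (Tm K₁ n) k → Vec (Tm K₂ n) k
    trV []       = []
    trV (t ∷ ts) = tr t ∷ trV ts

  trCtx : ∀ {n} → Ctx K₁ n → Ctx K₂ n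
  trCtx ∅       = ∅
  trCtx (Γ ▸ A) = trCtx Γ ▸ tr A

  IsMorphism : Set
  IsMorphism =
    ((c : Con K₁) → Typed T₂ (trCtx (ctxOf T₁ c)) (F c) (tr (typeOf T₁ c)))
    × ((r : RuleName T₁) →
        Steps T₂ (tr (Rule.lhs (rule T₁ r))) (tr (Rule.rhs (rule T₁ r))))

-- The translation |_|_F is a homomorphism for every term former except constants, where
-- it substitutes the translated arguments into F_c. Hence it commutes with simultaneous
-- substitution (the substitution lemma), which gives (1) and sends a β-redex to a
-- β-redex. A rule instance lσ ↪ rσ translates to |l|{|σ|} and |r|{|σ|}, which are
-- joined by instantiating the morphism condition |l| ↪* |r|. A step inside an argument
-- of c becomes a pointwise reduction of the substitution applied to F_c, and (3)
-- follows from (2) by folding over the equivalence closure. Only condition (ii) of a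
-- theory morphism is used.
module Submission where

open import Defs
open import Data.Nat using (suc)
open import Data.Fin using (Fin; zero; suc; _≟_)
open import Data.Vec using (Vec; []; _∷_; _∷ʳ_; lookup; reverse; map)
open import Data.Vec.Properties using (lookup-map; map-reverse; reverse-∷)
open import Data.Vec.Relation.Binary.Pointwise.Inductive as Pointwise
  using (Pointwise; []; _∷_)
open import Data.Product using (_×_; _,_; proj₂)
open import Function using (_∘_)
open import Relation.Nullary using (yes; no)
open import Relation.Binary.PropositionalEquality
open ≡-Reasoning
open import Relation.Binary.Construct.Closure.ReflexiveTransitive as Star
  using (Star; ε; _◅_; _◅◅_)
open import Relation.Binary.Construct.Closure.Symmetric using (fwd)
import Relation.Binary.Construct.Closure.Equivalence as EqClosure

Pointwise-∷ʳ : ∀ {A : Set} {_∼_ : A → A → Set} {k x y} {xs ys : Vec A k} →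
               Pointwise _∼_ xs ys → x ∼ y → Pointwise _∼_ (xs ∷ʳ x) (ys ∷ʳ y)
Pointwise-∷ʳ []          x∼y = x∼y ∷ []
Pointwise-∷ʳ (p ∷ xs∼ys) x∼y = p ∷ Pointwise-∷ʳ xs∼ys x∼y

Pointwise-reverse : ∀ {A : Set} {_∼_ : A → A → Set} {k} {xs ys : Vec A k} →
                    Pointwise _∼_ xs ys → Pointwise _∼_ (reverse xs) (reverse ys)
Pointwise-reverse [] = []
Pointwise-reverse {_∼_ = _∼_} (_∷_ {x = x} {y} {xs} {ys} x∼y xs∼ys) =
  subst₂ (Pointwise _∼_) (sym (reverse-∷ x xs)) (sym (reverse-∷ y ys))
    (Pointwise-∷ʳ (Pointwise-reverse xs∼ys) x∼y)

module Substitution (K : Consts) where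

  vecSub-map : ∀ {m n k} (f : Tm K m → Tm K n) (ts : Vec (Tm K m) k) (i : Fin k) →
               vecSub K (map f ts) i ≡ f (vecSub K ts i)
  vecSub-map f ts i = begin
    lookup (reverse (map f ts)) i ≡⟨ cong (λ v → lookup v i) (map-reverse f ts) ⟨
    lookup (map f (reverse ts)) i ≡⟨ lookup-map i f (reverse ts) ⟩
    f (lookup (reverse ts) i)     ∎

  vecSub-pointwise : ∀ {n k} {_∼_ : Tm K n → Tm K n → Set} {ts us : Vec (Tm K n) k} →
                     Pointwise _∼_ ts us → ∀ i → vecSub K ts i ∼ vecSub K us i
  vecSub-pointwise = Pointwise.lookup ∘ Pointwise-reverse

  extS-cong : ∀ {m n} {σ τ : Sub K m n} → (∀ i → σ i ≡ τ i) → ∀ i → extS K σ i ≡ extS K τ i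
  extS-cong σ≗τ zero    = refl
  extS-cong σ≗τ (suc i) = cong (ren K suc) (σ≗τ i)

  mutual
    sub-cong : ∀ {m n} {σ τ : Sub K m n} → (∀ i → σ i ≡ τ i) → (M : Tm K m) → sub K σ M ≡ sub K τ M
    sub-cong σ≗τ (var i)    = σ≗τ i
    sub-cong σ≗τ (con c ts) = cong (con c) (subV-cong σ≗τ ts)
    sub-cong σ≗τ TYPE       = refl
    sub-cong σ≗τ KIND       = refl
    sub-cong σ≗τ (app M N)  = cong₂ app (sub-cong σ≗τ M) (sub-cong σ≗τ N)
    sub-cong σ≗τ (lam A M)  = cong₂ lam (sub-cong σ≗τ A) (sub-cong (extS-cong σ≗τ) M)
    sub-cong σ≗τ (pi A B)   = cong₂ pi (sub-cong σ≗τ A) (sub-cong (extS-cong σ≗τ) B)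

    subV-cong : ∀ {m n k} {σ τ : Sub K m n} → (∀ i → σ i ≡ τ i) → (ts : Vec (Tm K m) k) →
                subV K σ ts ≡ subV K τ ts
    subV-cong σ≗τ []       = refl
    subV-cong σ≗τ (t ∷ ts) = cong₂ _∷_ (sub-cong σ≗τ t) (subV-cong σ≗τ ts)

  extS-var : ∀ {m n} (ρ : Ren K m n) i → extS K (var ∘ ρ) i ≡ var (extR K ρ i)
  extS-var ρ zero    = refl
  extS-var ρ (suc i) = refl

  mutual
    ren-as-sub : ∀ {m n} (ρ : Ren K m n) (M : Tm K m) → ren K ρ M ≡ sub K (var ∘ ρ) M
    ren-as-sub ρ (var i)    = refl
    ren-as-sub ρ (con c ts) = cong (con c) (renV-as-sub ρ ts)
    ren-as-sub ρ TYPE       = refl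
    ren-as-sub ρ KIND       = refl
    ren-as-sub ρ (app M N)  = cong₂ app (ren-as-sub ρ M) (ren-as-sub ρ N)
    ren-as-sub ρ (lam A M)  =
      cong₂ lam (ren-as-sub ρ A) (trans (ren-as-sub _ M) (sym (sub-cong (extS-var ρ) M)))
    ren-as-sub ρ (pi A B)   =
      cong₂ pi (ren-as-sub ρ A) (trans (ren-as-sub _ B) (sym (sub-cong (extS-var ρ) B)))

    renV-as-sub : ∀ {m n k} (ρ : Ren K m n) (ts : Vec (Tm K m) k) →
                  renV K ρ ts ≡ subV K (var ∘ ρ) ts
    renV-as-sub ρ []       = refl
    renV-as-sub ρ (t ∷ ts) = cong₂ _∷_ (ren-as-sub ρ t) (renV-as-sub ρ ts)

  ren-cong : ∀ {m n} {ρ ρ′ : Ren K m n} → (∀ i → ρ i ≡ ρ′ i) → (M : Tm K m) → ren K ρ M ≡ ren K ρ′ M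
  ren-cong {ρ = ρ} {ρ′} ρ≗ρ′ M = begin
    ren K ρ M            ≡⟨ ren-as-sub ρ M ⟩
    sub K (var ∘ ρ) M    ≡⟨ sub-cong (cong var ∘ ρ≗ρ′) M ⟩
    sub K (var ∘ ρ′) M   ≡⟨ ren-as-sub ρ′ M ⟨
    ren K ρ′ M           ∎

  extS-extR : ∀ {l m n} (σ : Sub K m n) (ρ : Ren K l m) i → extS K σ (extR K ρ i) ≡ extS K (σ ∘ ρ) i
  extS-extR σ ρ zero    = refl
  extS-extR σ ρ (suc i) = refl

  mutual
    sub-ren : ∀ {l m n} (σ : Sub K m n) (ρ : Ren K l m) (M : Tm K l) →
              sub K σ (ren K ρ M) ≡ sub K (σ ∘ ρ) M
    sub-ren σ ρ (var i)    = refl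
    sub-ren σ ρ (con c ts) = cong (con c) (subV-renV σ ρ ts)
    sub-ren σ ρ TYPE       = refl
    sub-ren σ ρ KIND       = refl
    sub-ren σ ρ (app M N)  = cong₂ app (sub-ren σ ρ M) (sub-ren σ ρ N)
    sub-ren σ ρ (lam A M)  =
      cong₂ lam (sub-ren σ ρ A) (trans (sub-ren _ _ M) (sub-cong (extS-extR σ ρ) M))
    sub-ren σ ρ (pi A B)   =
      cong₂ pi (sub-ren σ ρ A) (trans (sub-ren _ _ B) (sub-cong (extS-extR σ ρ) B))

    subV-renV : ∀ {l m n k} (σ : Sub K m n) (ρ : Ren K l m) (ts : Vec (Tm K l) k) →
                subV K σ (renV K ρ ts) ≡ subV K (σ ∘ ρ) ts
    subV-renV σ ρ []       = refl
    subV-renV σ ρ (t ∷ ts) = cong₂ _∷_ (sub-ren σ ρ t) (subV-renV σ ρ ts)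

  ren-ren : ∀ {l m n} (ρ : Ren K m n) (ρ′ : Ren K l m) (M : Tm K l) →
            ren K ρ (ren K ρ′ M) ≡ ren K (ρ ∘ ρ′) M
  ren-ren ρ ρ′ M = begin
    ren K ρ (ren K ρ′ M)          ≡⟨ ren-as-sub ρ (ren K ρ′ M) ⟩
    sub K (var ∘ ρ) (ren K ρ′ M)  ≡⟨ sub-ren (var ∘ ρ) ρ′ M ⟩
    sub K (var ∘ ρ ∘ ρ′) M        ≡⟨ ren-as-sub (ρ ∘ ρ′) M ⟨
    ren K (ρ ∘ ρ′) M              ∎

  extR-extS : ∀ {l m n} (ρ : Ren K m n) (σ : Sub K l m) i →
              ren K (extR K ρ) (extS K σ i) ≡ extS K (ren K ρ ∘ σ) i
  extR-extS ρ σ zero    = refl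
  extR-extS ρ σ (suc i) = trans (ren-ren _ suc (σ i)) (sym (ren-ren suc ρ (σ i)))

  mutual
    ren-sub : ∀ {l m n} (ρ : Ren K m n) (σ : Sub K l m) (M : Tm K l) →
              ren K ρ (sub K σ M) ≡ sub K (ren K ρ ∘ σ) M
    ren-sub ρ σ (var i)    = refl
    ren-sub ρ σ (con c ts) = cong (con c) (renV-subV ρ σ ts)
    ren-sub ρ σ TYPE       = refl
    ren-sub ρ σ KIND       = refl
    ren-sub ρ σ (app M N)  = cong₂ app (ren-sub ρ σ M) (ren-sub ρ σ N)
    ren-sub ρ σ (lam A M)  =
      cong₂ lam (ren-sub ρ σ A) (trans (ren-sub _ _ M) (sub-cong (extR-extS ρ σ) M))
    ren-sub ρ σ (pi A B)   =
      cong₂ pi (ren-sub ρ σ A) (trans (ren-sub _ _ B) (sub-cong (extR-extS ρ σ) B))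

    renV-subV : ∀ {l m n k} (ρ : Ren K m n) (σ : Sub K l m) (ts : Vec (Tm K l) k) →
                renV K ρ (subV K σ ts) ≡ subV K (ren K ρ ∘ σ) ts
    renV-subV ρ σ []       = refl
    renV-subV ρ σ (t ∷ ts) = cong₂ _∷_ (ren-sub ρ σ t) (renV-subV ρ σ ts)

  extS-extS : ∀ {l m n} (σ : Sub K m n) (τ : Sub K l m) i →
              sub K (extS K σ) (extS K τ i) ≡ extS K (sub K σ ∘ τ) i
  extS-extS σ τ zero    = refl
  extS-extS σ τ (suc i) = trans (sub-ren _ suc (τ i)) (sym (ren-sub suc σ (τ i)))

  mutual
    sub-sub : ∀ {l m n} (σ : Sub K m n) (τ : Sub K l m) (M : Tm K l) →
              sub K σ (sub K τ M) ≡ sub K (sub K σ ∘ τ) M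
    sub-sub σ τ (var i)    = refl
    sub-sub σ τ (con c ts) = cong (con c) (subV-subV σ τ ts)
    sub-sub σ τ TYPE       = refl
    sub-sub σ τ KIND       = refl
    sub-sub σ τ (app M N)  = cong₂ app (sub-sub σ τ M) (sub-sub σ τ N)
    sub-sub σ τ (lam A M)  =
      cong₂ lam (sub-sub σ τ A) (trans (sub-sub _ _ M) (sub-cong (extS-extS σ τ) M))
    sub-sub σ τ (pi A B)   =
      cong₂ pi (sub-sub σ τ A) (trans (sub-sub _ _ B) (sub-cong (extS-extS σ τ) B))

    subV-subV : ∀ {l m n k} (σ : Sub K m n) (τ : Sub K l m) (ts : Vec (Tm K l) k) →
                subV K σ (subV K τ ts) ≡ subV K (sub K σ ∘ τ) ts
    subV-subV σ τ []       = refl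
    subV-subV σ τ (t ∷ ts) = cong₂ _∷_ (sub-sub σ τ t) (subV-subV σ τ ts)

  extS-id : ∀ {n} (i : Fin (suc n)) → extS K var i ≡ var i
  extS-id zero    = refl
  extS-id (suc i) = refl

  mutual
    sub-id : ∀ {n} (M : Tm K n) → sub K var M ≡ M
    sub-id (var i)    = refl
    sub-id (con c ts) = cong (con c) (subV-id ts)
    sub-id TYPE       = refl
    sub-id KIND       = refl
    sub-id (app M N)  = cong₂ app (sub-id M) (sub-id N)
    sub-id (lam A M)  = cong₂ lam (sub-id A) (trans (sub-cong extS-id M) (sub-id M))
    sub-id (pi A B)   = cong₂ pi (sub-id A) (trans (sub-cong extS-id B) (sub-id B))

    subV-id : ∀ {n k} (ts : Vec (Tm K n) k) → subV K var ts ≡ ts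
    subV-id []       = refl
    subV-id (t ∷ ts) = cong₂ _∷_ (sub-id t) (subV-id ts)

  sub-[]₀ : ∀ {m n} (σ : Sub K m n) (M : Tm K (suc m)) (N : Tm K m) →
            sub K σ (_[_]₀ K M N) ≡ _[_]₀ K (sub K (extS K σ) M) (sub K σ N)
  sub-[]₀ σ M N = begin
    sub K σ (sub K (sub0 K N) M)                        ≡⟨ sub-sub σ (sub0 K N) M ⟩
    sub K (sub K σ ∘ sub0 K N) M                        ≡⟨ sub-cong lift M ⟩
    sub K (sub K (sub0 K (sub K σ N)) ∘ extS K σ) M     ≡⟨ sub-sub _ (extS K σ) M ⟨
    sub K (sub0 K (sub K σ N)) (sub K (extS K σ) M)     ∎
    where
    lift : ∀ i → sub K σ (sub0 K N i) ≡ sub K (sub0 K (sub K σ N)) (extS K σ i)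
    lift zero    = refl
    lift (suc i) = sym (trans (sub-ren _ suc (σ i)) (sub-id (σ i)))

module Rewriting (T : Theory) where
  private K = consts T
  open Substitution K

  mutual
    step-sub : ∀ {m n} (σ : Sub K m n) {M N} → Step T M N → Step T (sub K σ M) (sub K σ N)
    step-sub σ (β {M = M} {N}) = subst (Step T _) (sym (sub-[]₀ σ M N)) β
    step-sub σ (rw r τ)        =
      subst₂ (Step T) (sym (sub-sub σ τ (Rule.lhs (rule T r))))
                      (sym (sub-sub σ τ (Rule.rhs (rule T r))))
                      (rw r (sub K σ ∘ τ))
    step-sub σ (appL s)   = appL (step-sub σ s)
    step-sub σ (appR s)   = appR (step-sub σ s)
    step-sub σ (lamA s)   = lamA (step-sub σ s)
    step-sub σ (lamM s)   = lamM (step-sub _ s)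
    step-sub σ (piA s)    = piA (step-sub σ s)
    step-sub σ (piB s)    = piB (step-sub _ s)
    step-sub σ (conArg s) = conArg (stepV-subV σ s)

    stepV-subV : ∀ {m n k} (σ : Sub K m n) {ts us : Vec (Tm K m) k} →
                 StepV T ts us → StepV T (subV K σ ts) (subV K σ us)
    stepV-subV σ (here s)  = here (step-sub σ s)
    stepV-subV σ (there s) = there (stepV-subV σ s)

  steps-sub : ∀ {m n} (σ : Sub K m n) {M N} → Steps T M N → Steps T (sub K σ M) (sub K σ N)
  steps-sub σ = Star.gmap (sub K σ) (step-sub σ)

  steps-ren : ∀ {m n} (ρ : Ren K m n) {M N} → Steps T M N → Steps T (ren K ρ M) (ren K ρ N)
  steps-ren ρ {M} {N} M↪*N =
    subst₂ (Steps T) (sym (ren-as-sub ρ M)) (sym (ren-as-sub ρ N)) (steps-sub (var ∘ ρ) M↪*N)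

  stepsV-∷ : ∀ {n k} {t u : Tm K n} {ts us : Vec (Tm K n) k} →
             Steps T t u → Star (StepV T) ts us → Star (StepV T) (t ∷ ts) (u ∷ us)
  stepsV-∷ t↪*u ts↪*us = Star.gmap _ here t↪*u ◅◅ Star.gmap _ there ts↪*us

  extS-steps : ∀ {m n} {σ τ : Sub K m n} → (∀ i → Steps T (σ i) (τ i)) →
               ∀ i → Steps T (extS K σ i) (extS K τ i)
  extS-steps σ↪*τ zero    = ε
  extS-steps σ↪*τ (suc i) = steps-ren suc (σ↪*τ i)

  mutual
    sub-steps : ∀ {m n} {σ τ : Sub K m n} → (∀ i → Steps T (σ i) (τ i)) →
                (M : Tm K m) → Steps T (sub K σ M) (sub K τ M)
    sub-steps σ↪*τ (var i)    = σ↪*τ i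
    sub-steps σ↪*τ (con c ts) = Star.gmap _ conArg (subV-steps σ↪*τ ts)
    sub-steps σ↪*τ TYPE       = ε
    sub-steps σ↪*τ KIND       = ε
    sub-steps σ↪*τ (app M N)  =
      Star.gmap _ appL (sub-steps σ↪*τ M) ◅◅ Star.gmap _ appR (sub-steps σ↪*τ N)
    sub-steps σ↪*τ (lam A M)  =
      Star.gmap _ lamA (sub-steps σ↪*τ A) ◅◅ Star.gmap _ lamM (sub-steps (extS-steps σ↪*τ) M)
    sub-steps σ↪*τ (pi A B)   =
      Star.gmap _ piA (sub-steps σ↪*τ A) ◅◅ Star.gmap _ piB (sub-steps (extS-steps σ↪*τ) B)

    subV-steps : ∀ {m n k} {σ τ : Sub K m n} → (∀ i → Steps T (σ i) (τ i)) →
                 (ts : Vec (Tm K m) k) → Star (StepV T) (subV K σ ts) (subV K τ ts)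
    subV-steps σ↪*τ []       = ε
    subV-steps σ↪*τ (t ∷ ts) = stepsV-∷ (sub-steps σ↪*τ t) (subV-steps σ↪*τ ts)

module Translation (T₁ T₂ : Theory) (F : PreMorphism T₁ T₂) where
  private
    K₁ = consts T₁
    K₂ = consts T₂
    ⟦_⟧ : ∀ {n} → Tm K₁ n → Tm K₂ n
    ⟦_⟧ = tr T₁ T₂ F
  open Substitution
  open Rewriting T₂

  mutual
    tr-ren : ∀ {m n} (ρ : Ren K₁ m n) (M : Tm K₁ m) → ⟦ ren K₁ ρ M ⟧ ≡ ren K₂ ρ ⟦ M ⟧
    tr-ren ρ (var i)    = refl
    tr-ren ρ (con c ts) = begin
      sub K₂ (vecSub K₂ (trV T₁ T₂ F (renV K₁ ρ ts))) (F c)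
        ≡⟨ sub-cong K₂ (λ i → trans (cong (λ v → vecSub K₂ v i) (trV-renV ρ ts))
                                     (vecSub-map K₂ (ren K₂ ρ) (trV T₁ T₂ F ts) i)) (F c) ⟩
      sub K₂ (ren K₂ ρ ∘ vecSub K₂ (trV T₁ T₂ F ts)) (F c)
        ≡⟨ ren-sub K₂ ρ _ (F c) ⟨
      ren K₂ ρ ⟦ con c ts ⟧  ∎
    tr-ren ρ TYPE       = refl
    tr-ren ρ KIND       = refl
    tr-ren ρ (app M N)  = cong₂ app (tr-ren ρ M) (tr-ren ρ N)
    tr-ren ρ (lam A M)  = cong₂ lam (tr-ren ρ A) (trans (tr-ren _ M) (ren-cong K₂ extR-K₁≗K₂ ⟦ M ⟧))
    tr-ren ρ (pi A B)   = cong₂ pi (tr-ren ρ A) (trans (tr-ren _ B) (ren-cong K₂ extR-K₁≗K₂ ⟦ B ⟧))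

    trV-renV : ∀ {m n k} (ρ : Ren K₁ m n) (ts : Vec (Tm K₁ m) k) →
               trV T₁ T₂ F (renV K₁ ρ ts) ≡ map (ren K₂ ρ) (trV T₁ T₂ F ts)
    trV-renV ρ []       = refl
    trV-renV ρ (t ∷ ts) = cong₂ _∷_ (tr-ren ρ t) (trV-renV ρ ts)

    -- extR is defined separately for each signature, so the two lifts agree only pointwise.
    extR-K₁≗K₂ : ∀ {m n} {ρ : Ren K₁ m n} i → extR K₁ ρ i ≡ extR K₂ ρ i
    extR-K₁≗K₂ zero    = refl
    extR-K₁≗K₂ (suc i) = refl

  extS-tr : ∀ {m n} (σ : Sub K₁ m n) i → ⟦ extS K₁ σ i ⟧ ≡ extS K₂ (⟦_⟧ ∘ σ) i
  extS-tr σ zero    = refl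
  extS-tr σ (suc i) = tr-ren suc (σ i)

  mutual
    tr-sub : ∀ {m n} (σ : Sub K₁ m n) (M : Tm K₁ m) → ⟦ sub K₁ σ M ⟧ ≡ sub K₂ (⟦_⟧ ∘ σ) ⟦ M ⟧
    tr-sub σ (var i)    = refl
    tr-sub σ (con c ts) = begin
      sub K₂ (vecSub K₂ (trV T₁ T₂ F (subV K₁ σ ts))) (F c)
        ≡⟨ sub-cong K₂ (λ i → trans (cong (λ v → vecSub K₂ v i) (trV-subV σ ts))
                                     (vecSub-map K₂ (sub K₂ (⟦_⟧ ∘ σ)) (trV T₁ T₂ F ts) i)) (F c) ⟩
      sub K₂ (sub K₂ (⟦_⟧ ∘ σ) ∘ vecSub K₂ (trV T₁ T₂ F ts)) (F c)
        ≡⟨ sub-sub K₂ _ _ (F c) ⟨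
      sub K₂ (⟦_⟧ ∘ σ) ⟦ con c ts ⟧  ∎
    tr-sub σ TYPE       = refl
    tr-sub σ KIND       = refl
    tr-sub σ (app M N)  = cong₂ app (tr-sub σ M) (tr-sub σ N)
    tr-sub σ (lam A M)  = cong₂ lam (tr-sub σ A) (trans (tr-sub _ M) (sub-cong K₂ (extS-tr σ) ⟦ M ⟧))
    tr-sub σ (pi A B)   = cong₂ pi (tr-sub σ A) (trans (tr-sub _ B) (sub-cong K₂ (extS-tr σ) ⟦ B ⟧))

    trV-subV : ∀ {m n k} (σ : Sub K₁ m n) (ts : Vec (Tm K₁ m) k) →
               trV T₁ T₂ F (subV K₁ σ ts) ≡ map (sub K₂ (⟦_⟧ ∘ σ)) (trV T₁ T₂ F ts)
    trV-subV σ []       = refl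
    trV-subV σ (t ∷ ts) = cong₂ _∷_ (tr-sub σ t) (trV-subV σ ts)

  sub-tr : ∀ {m n} {σ : Sub K₁ m n} {τ : Sub K₂ m n} → (∀ i → τ i ≡ ⟦ σ i ⟧) →
           (M : Tm K₁ m) → sub K₂ τ ⟦ M ⟧ ≡ ⟦ sub K₁ σ M ⟧
  sub-tr τ≗⟦σ⟧ M = trans (sub-cong K₂ τ≗⟦σ⟧ ⟦ M ⟧) (sym (tr-sub _ M))

  subAt-tr : ∀ {n} (x : Fin n) (N : Tm K₁ n) y → subAt K₂ x ⟦ N ⟧ y ≡ ⟦ subAt K₁ x N y ⟧
  subAt-tr x N y with x ≟ y
  ... | yes _ = refl
  ... | no  _ = refl

  sub0-tr : ∀ {n} (N : Tm K₁ n) i → sub0 K₂ ⟦ N ⟧ i ≡ ⟦ sub0 K₁ N i ⟧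
  sub0-tr N zero    = refl
  sub0-tr N (suc i) = refl

  module _ (rules : ∀ r → Steps T₂ ⟦ Rule.lhs (rule T₁ r) ⟧ ⟦ Rule.rhs (rule T₁ r) ⟧) where

    mutual
      tr-step : ∀ {n} {M N : Tm K₁ n} → Step T₁ M N → Steps T₂ ⟦ M ⟧ ⟦ N ⟧
      tr-step (β {M = M} {N}) = β ◅ subst (Steps T₂ _) (sub-tr (sub0-tr N) M) ε
      tr-step (rw r σ)        =
        subst₂ (Steps T₂) (sub-tr (λ _ → refl) (Rule.lhs (rule T₁ r)))
                          (sub-tr (λ _ → refl) (Rule.rhs (rule T₁ r)))
                          (steps-sub (⟦_⟧ ∘ σ) (rules r))
      tr-step (appL s)        = Star.gmap _ appL (tr-step s)
      tr-step (appR s)        = Star.gmap _ appR (tr-step s)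
      tr-step (lamA s)        = Star.gmap _ lamA (tr-step s)
      tr-step (lamM s)        = Star.gmap _ lamM (tr-step s)
      tr-step (piA s)         = Star.gmap _ piA (tr-step s)
      tr-step (piB s)         = Star.gmap _ piB (tr-step s)
      tr-step (conArg {c} s)  = sub-steps (vecSub-pointwise K₂ (trV-stepV s)) (F c)

      trV-stepV : ∀ {n k} {ts us : Vec (Tm K₁ n) k} → StepV T₁ ts us →
                  Pointwise (Steps T₂) (trV T₁ T₂ F ts) (trV T₁ T₂ F us)
      trV-stepV (here s)  = tr-step s ∷ Pointwise.refl ε
      trV-stepV (there s) = ε ∷ trV-stepV s

    tr-conv : ∀ {n} {M N : Tm K₁ n} → Conv T₁ M N → Conv T₂ ⟦ M ⟧ ⟦ N ⟧
    tr-conv {n} = EqClosure.gfold (EqClosure.isEquivalence (Step T₂ {n})) ⟦_⟧ (Star.map fwd ∘ tr-step)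

mainTheorem17 : (T₁ T₂ : Theory) (F : PreMorphism T₁ T₂) → IsMorphism T₁ T₂ F →
    (∀ {n} (x : Fin n) (M N : Tm (consts T₁) n) →
    sub (consts T₂) (subAt (consts T₂) x (tr T₁ T₂ F N)) (tr T₁ T₂ F M)
    ≡ tr T₁ T₂ F (sub (consts T₁) (subAt (consts T₁) x N) M))
    × (∀ {n} {M N : Tm (consts T₁) n} → Step T₁ M N →
    Steps T₂ (tr T₁ T₂ F M) (tr T₁ T₂ F N))
    × (∀ {n} {M N : Tm (consts T₁) n} → Conv T₁ M N →
    Conv T₂ (tr T₁ T₂ F M) (tr T₁ T₂ F N))
mainTheorem17 T₁ T₂ F isMorphism =
    (λ x M N → sub-tr (subAt-tr x N) M)
  , tr-step (proj₂ isMorphism)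
  , tr-conv (proj₂ isMorphism)
  where open Translation T₁ T₂ F
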